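{- Let $G$ be a finite simple $d$-regular Vizing-class-2 graph and let $c:E(G)\rightarrow\{1,2,\dots,d+1\}$ be a proper edge coloring of $G$. For each vertex $v$, let $a_v$ denote the unique element of $\{1,\dots,d+1\}$ that does not appear on an edge incident to $v$ in $c$. If for every path $v_1,v_2,v_3$ of length $2$ in $G$, either $a_{v_1}-a_{v_3}=0$ or $a_{v_1}-a_{v_3}$ is odd, then $c$ is an additive edge coloring of $G$. Thus, if $G$ admits such a coloring, $\eta'_p(G)=d+1$.
   Context: A $d$-regular graph is Vizing-class-2 if its chromatic index equals $d+1$. For an edge $e$, $N'(e)$ is the set of edges other than $e$ sharing an endpoint with $e$. An additive edge coloring is a map $c:E(G)\to\mathbb{N}$ such that for any two edges $e_1,e_2$ sharing an endpoint, $\sum_{e\in N'(e_1)}c(e)\neq\sum_{e\in N'(e_2)}c(e)$. $\eta_p'(G)$ is the least $k$ such that $G$ has a proper edge coloring with labels in $\{1,\ldots,k\}$ that is also an additive edge coloring. -}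

module Defs where

open import Data.Nat using (ℕ; _+_; _≤_; _<_; suc; ∣_-_∣)
open import Data.Nat.Divisibility using (_∣_)
open import Data.Fin using (Fin)
open import Data.Fin.Properties using (_≟_)
open import Data.Bool using (Bool; true; false; if_then_else_; _∧_; not)
open import Data.List using (List; map; length; filter)
open import Data.Nat.ListAction using (sum)
open import Data.List using () renaming (map to lmap)
open import Data.Fin.Base using ()
open import Data.List.Base using ()
open import Data.Product using (Σ; _×_)
open import Data.Sum using (_⊎_)
open import Relation.Nullary using (¬_; does)
open import Relation.Binary.PropositionalEquality using (_≡_; _≢_)
open import Data.List.Base using () renaming (tabulate to ltabulate)

allV : (n : ℕ) → List (Fin n)
allV n = ltabulate (λ i → i)

record Graph : Set where
  field
    n      : ℕ
    adj    : Fin n → Fin n → Bool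
    sym    : ∀ u v → adj u v ≡ adj v u
    irrefl : ∀ v → adj v v ≡ false
open Graph public

deg : (G : Graph) → Fin (n G) → ℕ
deg G v = length (filter (λ w → adj G v w ≟B true) (allV (n G)))
  where
  open import Data.Bool.Properties renaming (_≟_ to _≟B_)

Regular : Graph → ℕ → Set
Regular G d = ∀ v → deg G v ≡ d

-- An edge labelling: col u v is the label of edge uv (only values on
-- edges matter); it must be symmetric on edges.
Labelling : Graph → Set
Labelling G = Fin (n G) → Fin (n G) → ℕ

ProperEdgeColoring : (G : Graph) → ℕ → Labelling G → Set
ProperEdgeColoring G k col =
  (∀ u v → adj G u v ≡ true → col u v ≡ col v u)
  × (∀ u v → adj G u v ≡ true → (1 ≤ col u v) × (col u v ≤ k))
  × (∀ u v w → adj G u v ≡ true → adj G u w ≡ true → v ≢ w → col u v ≢ col u w)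

ChromaticIndex : Graph → ℕ → Set
ChromaticIndex G k =
  Σ (Labelling G) (ProperEdgeColoring G k)
  × (∀ j → j < k → (col : Labelling G) → ¬ ProperEdgeColoring G j col)

VizingClass2 : Graph → ℕ → Set
VizingClass2 G d = Regular G d × ChromaticIndex G (suc d)

sumAtExcept : (G : Graph) → Labelling G → Fin (n G) → Fin (n G) → ℕ
sumAtExcept G col x y =
  sum (map (λ w → if adj G x w ∧ not (does (w ≟ y)) then col x w else 0) (allV (n G)))

neighSum : (G : Graph) → Labelling G → Fin (n G) → Fin (n G) → ℕ
neighSum G col u v = sumAtExcept G col u v + sumAtExcept G col v u

Additive : (G : Graph) → Labelling G → Set
Additive G col =
  ∀ u v w → adj G u v ≡ true → adj G u w ≡ true → v ≢ w →
  neighSum G col u v ≢ neighSum G col u w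

EtaP : Graph → ℕ → Set
EtaP G k =
  Σ (Labelling G) (λ col → ProperEdgeColoring G k col × Additive G col)
  × (∀ j → j < k → (col : Labelling G) → ¬ (ProperEdgeColoring G j col × Additive G col))

MissingColor : (G : Graph) → ℕ → Labelling G → (Fin (n G) → ℕ) → Set
MissingColor G k col a =
  ∀ v → (1 ≤ a v) × (a v ≤ k) × (∀ u → adj G v u ≡ true → col v u ≢ a v)

PathCondition : (G : Graph) → (Fin (n G) → ℕ) → Set
PathCondition G a =
  ∀ v₁ v₂ v₃ → adj G v₁ v₂ ≡ true → adj G v₂ v₃ ≡ true → v₁ ≢ v₃ →
  (a v₁ ≡ a v₃) ⊎ ¬ (2 ∣ ∣ a v₁ - a v₃ ∣)

-- At every vertex v the d colours on the edges at v, together with the missing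
-- colour a_v, are exactly 1, …, d+1, so Σ_{e ∋ v} c(e) + a_v = (d+1)(d+2)/2 for
-- all v.  For an edge uv this makes Σ_{N'(uv)} c + 2c(uv) + a_v depend on u alone,
-- so two edges uv, uw with equal neighbourhood sums satisfy
-- 2c(uv) + a_v = 2c(uw) + a_w.  Then a_v − a_w is even, hence zero by the path
-- condition on v u w, and c(uv) = c(uw) contradicts properness.  The lower bound
-- for η'_p is the chromatic index.
module Submission where

open import Defs hiding (sym)
open import Data.Bool.Base using (Bool; true; false; if_then_else_; _∧_; not)
import Data.Bool.Properties as Bool
open import Data.Fin.Base using (Fin)
import Data.Fin.Properties as Fin
open import Data.List.Base using (List; []; _∷_; _++_; map; length; filter)
open import Data.List.Properties using (length-map; map-cong-local)
open import Data.List.Membership.Propositional using (_∈_; _∉_)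
open import Data.List.Membership.Propositional.Properties using (∈-∃++; ∈-tabulate⁺)
open import Data.List.Relation.Unary.All as All using (All; []; _∷_)
open import Data.List.Relation.Unary.All.Properties using (all-filter; map⁺)
open import Data.List.Relation.Unary.Any using (here; there)
open import Data.List.Relation.Unary.AllPairs as AllPairs using (AllPairs; []; _∷_)
import Data.List.Relation.Unary.AllPairs.Properties as AllPairs
open import Data.List.Relation.Unary.Unique.Propositional using (Unique)
open import Data.List.Relation.Unary.Unique.Propositional.Properties
  using (Unique[x∷xs]⇒x∉xs; tabulate⁺; filter⁺)
open import Data.List.Relation.Binary.Permutation.Propositional using (_↭_; ↭⇒↭ₛ)
open import Data.List.Relation.Binary.Permutation.Propositional.Properties
  using (shift; ↭-length; All-resp-↭)
import Data.List.Relation.Binary.Permutation.Setoid.Properties as Setoid↭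
open import Data.Nat.Base using (ℕ; zero; suc; _+_; _*_; _≤_; z≤n; s≤s; ∣_-_∣)
open import Data.Nat.Properties
open import Data.Nat.Divisibility using (_∣_; m∣m*n)
open import Data.Nat.ListAction using (sum)
open import Data.Nat.ListAction.Properties using (sum-↭)
open import Data.Nat.Tactic.RingSolver using (solve-∀)
open import Data.List.Membership.DecPropositional _≟_ using (_∈?_)
open import Data.Product.Base using (∃; _×_; _,_; proj₁; proj₂)
open import Data.Sum.Base using (_⊎_; inj₁; inj₂)
open import Function.Base using (id)
open import Relation.Nullary using (¬_; does; yes; no; contradiction)
open import Relation.Binary.Definitions using (DecidableEquality)
open import Relation.Binary.PropositionalEquality

unique-resp-↭ : ∀ {A : Set} {xs ys : List A} → xs ↭ ys → Unique xs → Unique ys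
unique-resp-↭ {A} p = Setoid↭.Unique-resp-↭ (setoid A) (↭⇒↭ₛ p)

∈⇒↭∷ : ∀ {A : Set} {x : A} {xs} → x ∈ xs → ∃ λ ys → xs ↭ x ∷ ys
∈⇒↭∷ {x = x} x∈xs with ys , zs , refl ← ∈-∃++ x∈xs = ys ++ zs , shift x ys zs

InRange : ℕ → ℕ → Set
InRange m x = 1 ≤ x × x ≤ m

triangle : ℕ → ℕ
triangle zero    = 0
triangle (suc m) = suc m + triangle m

inRange-pred : ∀ {k xs} → suc k ∉ xs → All (InRange (suc k)) xs → All (InRange k) xs
inRange-pred {k} {xs} k∉xs rs = All.tabulate bound
  where
  bound : ∀ {x} → x ∈ xs → InRange k x
  bound {x} x∈xs with 1≤x , x≤1+k ← All.lookup rs x∈xs =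
    1≤x , ≤-pred (≤∧≢⇒< x≤1+k λ { refl → k∉xs x∈xs })

remove-top : ∀ {k xs} → Unique xs → All (InRange (suc k)) xs → suc k ∈ xs →
             ∃ λ ys → xs ↭ suc k ∷ ys × Unique ys × All (InRange k) ys
remove-top u rs k∈xs with ys , p ← ∈⇒↭∷ k∈xs with u′ ← unique-resp-↭ p u =
  ys , p , AllPairs.tail u′ , inRange-pred (Unique[x∷xs]⇒x∉xs u′) (All.tail (All-resp-↭ p rs))

unique-inRange⇒length≤ : ∀ m {xs} → Unique xs → All (InRange m) xs → length xs ≤ m
unique-inRange⇒length≤ zero    _ []                  = z≤n
unique-inRange⇒length≤ zero    _ ((1≤x , x≤0) ∷ _)   = contradiction (≤-trans 1≤x x≤0) λ ()
unique-inRange⇒length≤ (suc k) {xs} u rs with suc k ∈? xs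
... | no k∉xs = m≤n⇒m≤1+n (unique-inRange⇒length≤ k u (inRange-pred k∉xs rs))
... | yes k∈xs with ys , p , u′ , rs′ ← remove-top u rs k∈xs =
  subst (_≤ suc k) (sym (↭-length p)) (s≤s (unique-inRange⇒length≤ k u′ rs′))

unique-inRange-length≡⇒sum≡triangle :
  ∀ m {xs} → Unique xs → All (InRange m) xs → length xs ≡ m → sum xs ≡ triangle m
unique-inRange-length≡⇒sum≡triangle zero    {[]} _ _ _ = refl
unique-inRange-length≡⇒sum≡triangle (suc k) {xs} u rs |xs| with suc k ∈? xs
... | no k∉xs = contradiction
  (subst (_≤ k) |xs| (unique-inRange⇒length≤ k u (inRange-pred k∉xs rs))) 1+n≰n
... | yes k∈xs with ys , p , u′ , rs′ ← remove-top u rs k∈xs = begin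
  sum xs            ≡⟨ sum-↭ p ⟩
  suc k + sum ys    ≡⟨ cong (suc k +_) (unique-inRange-length≡⇒sum≡triangle k u′ rs′ |ys|) ⟩
  suc k + triangle k ∎
  where
  open ≡-Reasoning
  |ys| : length ys ≡ k
  |ys| = suc-injective (trans (sym (↭-length p)) |xs|)

module _ {A : Set} (_≟ᴬ_ : DecidableEquality A) (p : A → Bool) (f : A → ℕ) where

  restrict : A → ℕ
  restrict w = if p w then f w else 0

  restrictExcept : A → A → ℕ
  restrictExcept y w = if p w ∧ not (does (w ≟ᴬ y)) then f w else 0

  restrictExcept-≢ : ∀ {y w} → w ≢ y → restrictExcept y w ≡ restrict w
  restrictExcept-≢ {y} {w} w≢y with w ≟ᴬ y
  ... | yes w≡y = contradiction w≡y w≢y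
  ... | no _    = cong (λ b → if b then f w else 0) (Bool.∧-identityʳ (p w))

  restrictExcept-self : ∀ y → restrictExcept y y ≡ 0
  restrictExcept-self y with y ≟ᴬ y
  ... | yes _   = cong (λ b → if b then f y else 0) (Bool.∧-zeroʳ (p y))
  ... | no y≢y = contradiction refl y≢y

  sum-restrictExcept : ∀ {y xs} → Unique xs → y ∈ xs → p y ≡ true →
                       sum (map (restrictExcept y) xs) + f y ≡ sum (map restrict xs)
  sum-restrictExcept {y} {y ∷ xs} (y∉xs ∷ _) (here refl) py = begin
    restrictExcept y y + sum (map (restrictExcept y) xs) + f y
      ≡⟨ cong (λ t → t + sum (map (restrictExcept y) xs) + f y) (restrictExcept-self y) ⟩
    sum (map (restrictExcept y) xs) + f y
      ≡⟨ cong (λ ws → sum ws + f y) (map-cong-local (All.map (λ y≢w → restrictExcept-≢ (≢-sym y≢w)) y∉xs)) ⟩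
    sum (map restrict xs) + f y
      ≡⟨ +-comm _ (f y) ⟩
    f y + sum (map restrict xs)
      ≡⟨ cong (λ b → (if b then f y else 0) + sum (map restrict xs)) (sym py) ⟩
    restrict y + sum (map restrict xs) ∎
    where open ≡-Reasoning
  sum-restrictExcept {y} {x ∷ xs} (x∉xs ∷ u) (there y∈xs) py =
    trans (+-assoc (restrictExcept y x) _ (f y))
          (cong₂ _+_ (restrictExcept-≢ (All.lookup x∉xs y∈xs)) (sum-restrictExcept u y∈xs py))

  sum-restrict : ∀ xs → sum (map restrict xs) ≡ sum (map f (filter (λ w → p w Bool.≟ true) xs))
  sum-restrict []       = refl
  sum-restrict (x ∷ xs) with p x
  ... | true  = cong (f x +_) (sum-restrict xs)
  ... | false = sum-restrict xs

allPairs-within : ∀ {A : Set} {P : A → Set} {R S : A → A → Set} {xs} →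
                  (∀ {v w} → P v → P w → R v w → S v w) → All P xs → AllPairs R xs → AllPairs S xs
allPairs-within f []         []          = []
allPairs-within f (pv ∷ pvs) (rv ∷ rvs) =
  All.zipWith (λ (pw , r) → f pv pw r) (pvs , rv) ∷ allPairs-within f pvs rvs

2*k+x≡2*l+x⇒k≡l : ∀ k l x → 2 * k + x ≡ 2 * l + x → k ≡ l
2*k+x≡2*l+x⇒k≡l k l x e = *-cancelˡ-≡ k l 2 (+-cancelʳ-≡ x (2 * k) (2 * l) e)

2*k+x≡2*l+y⇒2∣∣x-y∣ : ∀ k l x y → 2 * k + x ≡ 2 * l + y → 2 ∣ ∣ x - y ∣
2*k+x≡2*l+y⇒2∣∣x-y∣ k l x y e = subst (2 ∣_) 2∣l-k∣≡∣x-y∣ (m∣m*n ∣ l - k ∣)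
  where
  open ≡-Reasoning
  2∣l-k∣≡∣x-y∣ : 2 * ∣ l - k ∣ ≡ ∣ x - y ∣
  2∣l-k∣≡∣x-y∣ = begin
    2 * ∣ l - k ∣                   ≡⟨ *-distribˡ-∣-∣ 2 l k ⟩
    ∣ 2 * l - 2 * k ∣               ≡⟨ sym (∣m+n-m+o∣≡∣n-o∣ y (2 * l) (2 * k)) ⟩
    ∣ y + 2 * l - y + 2 * k ∣       ≡⟨ cong₂ ∣_-_∣ (+-comm y (2 * l)) (+-comm y (2 * k)) ⟩
    ∣ 2 * l + y - 2 * k + y ∣       ≡⟨ cong (∣_- 2 * k + y ∣) (sym e) ⟩
    ∣ 2 * k + x - 2 * k + y ∣       ≡⟨ ∣m+n-m+o∣≡∣n-o∣ (2 * k) x y ⟩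
    ∣ x - y ∣                       ∎

2*k+x≡2*l+y⇒k≡l : ∀ {k l x y} → x ≡ y ⊎ ¬ 2 ∣ ∣ x - y ∣ → 2 * k + x ≡ 2 * l + y → k ≡ l
2*k+x≡2*l+y⇒k≡l {k} {l} {x} (inj₁ refl) e = 2*k+x≡2*l+x⇒k≡l k l x e
2*k+x≡2*l+y⇒k≡l {k} {l} {x} {y} (inj₂ odd) e = contradiction (2*k+x≡2*l+y⇒2∣∣x-y∣ k l x y e) odd

neighbours : (G : Graph) → Fin (n G) → List (Fin (n G))
neighbours G x = filter (λ w → adj G x w Bool.≟ true) (allV (n G))

colours : (G : Graph) → Labelling G → Fin (n G) → List ℕ
colours G col x = map (col x) (neighbours G x)

allV-unique : ∀ m → Unique (allV m)
allV-unique m = tabulate⁺ id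

sumAtExcept+col≡sum-colours : ∀ G col {x y} → adj G x y ≡ true →
                              sumAtExcept G col x y + col x y ≡ sum (colours G col x)
sumAtExcept+col≡sum-colours G col {x} {y} xy =
  trans (sum-restrictExcept Fin._≟_ (adj G x) (col x) (allV-unique (n G)) (∈-tabulate⁺ y) xy)
        (sum-restrict Fin._≟_ (adj G x) (col x) (allV (n G)))

module _ (G : Graph) (d : ℕ) (col : Labelling G) (a : Fin (n G) → ℕ)
         (regular : Regular G d) (proper : ProperEdgeColoring G (suc d) col)
         (missing : MissingColor G (suc d) col a) where

  missing+sum-colours≡triangle : ∀ x → a x + sum (colours G col x) ≡ triangle (suc d)
  missing+sum-colours≡triangle x
    with 1≤ax , ax≤1+d , ax-missing ← missing x =
    unique-inRange-length≡⇒sum≡triangle (suc d) unique inRange (cong suc length≡d)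
    where
    adjacent : All (λ w → adj G x w ≡ true) (neighbours G x)
    adjacent = all-filter (λ w → adj G x w Bool.≟ true) (allV (n G))
    unique : Unique (a x ∷ colours G col x)
    unique = map⁺ (All.map (λ xw ax≡ → ax-missing _ xw (sym ax≡)) adjacent)
           ∷ AllPairs.map⁺ (allPairs-within (proj₂ (proj₂ proper) x _ _) adjacent (filter⁺ _ (allV-unique (n G))))
    inRange : All (InRange (suc d)) (a x ∷ colours G col x)
    inRange = (1≤ax , ax≤1+d) ∷ map⁺ (All.map (proj₁ (proj₂ proper) x _) adjacent)
    length≡d : length (colours G col x) ≡ d
    length≡d = trans (length-map (col x) (neighbours G x)) (regular x)

  neighSum+weight≡ : ∀ {u v} → adj G u v ≡ true →
    neighSum G col u v + (2 * col u v + a v) ≡ sum (colours G col u) + triangle (suc d)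
  neighSum+weight≡ {u} {v} uv = begin
    eᵤ + eᵥ + (2 * col u v + a v)           ≡⟨ rearrange eᵤ eᵥ (col u v) (a v) ⟩
    (eᵤ + col u v) + (a v + (eᵥ + col u v)) ≡⟨ cong₂ (λ s t → s + (a v + t)) eᵤ+c eᵥ+c ⟩
    Σᵤ + (a v + sum (colours G col v))      ≡⟨ cong (Σᵤ +_) (missing+sum-colours≡triangle v) ⟩
    Σᵤ + triangle (suc d)                   ∎
    where
    open ≡-Reasoning
    eᵤ eᵥ Σᵤ : ℕ
    eᵤ = sumAtExcept G col u v
    eᵥ = sumAtExcept G col v u
    Σᵤ = sum (colours G col u)
    rearrange : ∀ s t c m → s + t + (2 * c + m) ≡ (s + c) + (m + (t + c))
    rearrange = solve-∀
    eᵤ+c : eᵤ + col u v ≡ Σᵤ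
    eᵤ+c = sumAtExcept+col≡sum-colours G col uv
    eᵥ+c : eᵥ + col u v ≡ sum (colours G col v)
    eᵥ+c = trans (cong (eᵥ +_) (proj₁ proper u v uv))
                 (sumAtExcept+col≡sum-colours G col (trans (Graph.sym G v u) uv))

  neighSum≡⇒weight≡ : ∀ {u v w} → adj G u v ≡ true → adj G u w ≡ true →
    neighSum G col u v ≡ neighSum G col u w → 2 * col u v + a v ≡ 2 * col u w + a w
  neighSum≡⇒weight≡ {u} {v} {w} uv uw sums≡ = +-cancelˡ-≡ (neighSum G col u v) _ _ (begin
    neighSum G col u v + (2 * col u v + a v)  ≡⟨ neighSum+weight≡ uv ⟩
    sum (colours G col u) + triangle (suc d)  ≡⟨ neighSum+weight≡ uw ⟨
    neighSum G col u w + (2 * col u w + a w)  ≡⟨ cong (_+ (2 * col u w + a w)) sums≡ ⟨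
    neighSum G col u v + (2 * col u w + a w)  ∎)
    where open ≡-Reasoning

proposition2p6 : (G : Graph) (d : ℕ) → VizingClass2 G d →
    (col : Labelling G) → ProperEdgeColoring G (suc d) col →
    (a : Fin (n G) → ℕ) → MissingColor G (suc d) col a →
    PathCondition G a →
    Additive G col × EtaP G (suc d)
proposition2p6 G d (regular , _ , noFewerColours) col proper@(_ , _ , colProper) a missing path =
  additive , (col , proper , additive) , λ j j<1+d col′ (proper′ , _) → noFewerColours j j<1+d col′ proper′
  where
  additive : Additive G col
  additive u v w uv uw v≢w sums≡ =
    colProper u v w uv uw v≢w
      (2*k+x≡2*l+y⇒k≡l (path v u w (trans (Graph.sym G v u) uv) uw v≢w)
                       (neighSum≡⇒weight≡ G d col a regular proper missing uv uw sums≡))
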